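{- Let $m\ge3$ be odd. The map $P:A_m\to A_m$, $P(w)=w+q_{p(Z(w))}$, is a bijection. Consequently, every layer map $P_{t,c}:A_m\to A_m$, $P_{t,c}(w)=w+q_{d_t(w,c)}$ ($t\in\mathbb Z_m$, $c\in\mathbb Z_5$), of the schedule $(\mathrm{Sch}_{\ge5})$ (when $m\ge5$) or $(\mathrm{Sch}_3)$ (when $m=3$) is a bijection.
   Context: Indices in $\mathbb Z_5=\{0,\dots,4\}$. $A_m=\{w\in(\mathbb Z_m)^5:\sum_i w_i=0\}$; $e_i$ standard basis vectors; $q_i=e_i-e_4$ ($i=0,1,2,3$), $q_4=0$. For $w\in A_m$, $Z(w)=\{i:w_i=0\}$ and $S(w)=Z(w)-1=\{i-1:i\in Z(w)\}$. A table $\Lambda_1$ assigns to each subset $S\subseteq\mathbb Z_5$ a permutation $\Lambda_1(S)$ of $\mathbb Z_5$, written as $(\Lambda_1(S)(0),\dots,\Lambda_1(S)(4))$, given on representatives by $\Lambda_1(\varnothing)=(0,1,2,3,4)$, $\Lambda_1(\{0\})=(0,1,3,2,4)$, $\Lambda_1(\{0,1\})=(4,1,3,2,0)$, $\Lambda_1(\{0,2\})=(4,1,3,0,2)$, $\Lambda_1(\{0,1,2\})=(1,0,3,4,2)$, $\Lambda_1(\{0,1,3\})=(4,3,0,2,1)$, $\Lambda_1(\{0,1,2,3,4\})=(0,1,2,3,4)$, and extended to all needed subsets by cyclic equivariance $\Lambda_1(S+k)(a+k)=\Lambda_1(S)(a)+k \pmod 5$. The selector is $p(Z)=\Lambda_1(Z-1)(0)$.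 Schedule $(\mathrm{Sch}_{\ge5})$ (for odd $m\ge5$): $d_0(w,c)=c$, $d_1(w,c)=\Lambda_1(S(w))(c)$, $d_2(w,c)=c+3$, $d_3(w,c)=c+4$, $d_t(w,c)=c$ for $4\le t\le m-1$. Schedule $(\mathrm{Sch}_3)$ (for $m=3$): $d_0(w,c)=c+4$, $d_1(w,c)=\Lambda_1(S(w))(c)$, $d_2(w,c)=c+3$. -}

module Defs where

open import Data.Nat using (ℕ; zero; suc; _+_; _∸_; NonZero)
open import Data.Nat.DivMod using (_mod_)
open import Data.Fin using (Fin; toℕ; #_; _≟_)
open import Data.Fin.Subset using (Subset; inside; outside)
open import Data.Bool using (Bool; true; false; if_then_else_)
import Data.Bool as B
open import Data.Vec using (Vec; []; _∷_; lookup; tabulate; zipWith; foldr)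
open import Data.Vec.Properties using (≡-dec)
open import Data.List using (List; []; _∷_)
open import Data.Maybe using (Maybe; just; nothing)
open import Data.Product using (_×_; _,_; Σ; ∃)
open import Relation.Nullary using (yes; no; does)
open import Relation.Binary.PropositionalEquality using (_≡_)

module _ {m : ℕ} .{{_ : NonZero m}} where

  ι : ℕ → Fin m
  ι k = k mod m

  0m : Fin m
  0m = ι 0

  1m : Fin m
  1m = ι 1

  infixl 6 _⊕_ _⊖_
  infix 8 ⊖_

  _⊕_ : Fin m → Fin m → Fin m
  a ⊕ b = ι (toℕ a + toℕ b)

  ⊖_ : Fin m → Fin m
  ⊖ a = ι (m ∸ toℕ a)

  _⊖_ : Fin m → Fin m → Fin m
  a ⊖ b = a ⊕ (⊖ b)

  V : Set
  V = Vec (Fin m) 5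

  _+v_ : V → V → V
  _+v_ = zipWith _⊕_

  _-v_ : V → V → V
  _-v_ = zipWith _⊖_

  sumV : V → Fin m
  sumV = foldr _ _⊕_ 0m

  InA : V → Set
  InA w = sumV w ≡ 0m

  e : Fin 5 → V
  e i = tabulate (λ j → if does (i ≟ j) then 1m else 0m)

  q : Fin 5 → V
  q i = if does (i ≟ # 4) then tabulate (λ _ → 0m) else (e i -v e (# 4))

  Z : V → Subset 5
  Z w = tabulate (λ i → does (lookup w i ≟ 0m))

  BijOnA : (V → V) → Set
  BijOnA f =
    (∀ w → InA w → InA (f w)) ×
    (∀ w w′ → InA w → InA w′ → f w ≡ f w′ → w ≡ w′) ×
    (∀ v → InA v → Σ V (λ w → InA w × f w ≡ v))

shiftDown : Subset 5 → Subset 5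
shiftDown S = tabulate (λ j → lookup S (j ⊕ (# 1)))

rotate : Subset 5 → Fin 5 → Subset 5
rotate R k = tabulate (λ j → lookup R (j ⊖ k))

-- build a subset from a membership list of length 5
-- representatives S with their permutations Λ₁(S) = (Λ₁(S)(0),…,Λ₁(S)(4))
I O : Bool
I = inside
O = outside

reps : List (Subset 5 × Vec (Fin 5) 5)
reps =
    ((O ∷ O ∷ O ∷ O ∷ O ∷ []) , (# 0 ∷ # 1 ∷ # 2 ∷ # 3 ∷ # 4 ∷ []))
  ∷ ((I ∷ O ∷ O ∷ O ∷ O ∷ []) , (# 0 ∷ # 1 ∷ # 3 ∷ # 2 ∷ # 4 ∷ []))
  ∷ ((I ∷ I ∷ O ∷ O ∷ O ∷ []) , (# 4 ∷ # 1 ∷ # 3 ∷ # 2 ∷ # 0 ∷ []))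
  ∷ ((I ∷ O ∷ I ∷ O ∷ O ∷ []) , (# 4 ∷ # 1 ∷ # 3 ∷ # 0 ∷ # 2 ∷ []))
  ∷ ((I ∷ I ∷ I ∷ O ∷ O ∷ []) , (# 1 ∷ # 0 ∷ # 3 ∷ # 4 ∷ # 2 ∷ []))
  ∷ ((I ∷ I ∷ O ∷ I ∷ O ∷ []) , (# 4 ∷ # 3 ∷ # 0 ∷ # 2 ∷ # 1 ∷ []))
  ∷ ((I ∷ I ∷ I ∷ I ∷ I ∷ []) , (# 0 ∷ # 1 ∷ # 2 ∷ # 3 ∷ # 4 ∷ []))
  ∷ []

allK : List (Fin 5)
allK = # 0 ∷ # 1 ∷ # 2 ∷ # 3 ∷ # 4 ∷ []

-- if S = R + k for some k, return a ↦ Λ₁(R)(a - k) + k  (cyclic equivariance)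
tryRep : Subset 5 × Vec (Fin 5) 5 → Subset 5 → List (Fin 5) → Maybe (Fin 5 → Fin 5)
tryRep (R , π) S [] = nothing
tryRep (R , π) S (k ∷ ks) with ≡-dec B._≟_ (rotate R k) S
... | yes _ = just (λ a → lookup π (a ⊖ k) ⊕ k)
... | no _  = tryRep (R , π) S ks

findΛ : List (Subset 5 × Vec (Fin 5) 5) → Subset 5 → Maybe (Fin 5 → Fin 5)
findΛ [] S = nothing
findΛ (r ∷ rs) S with tryRep r S allK
... | just f  = just f
... | nothing = findΛ rs S

-- Λ₁(S). Every subset of ℤ_5 except the 4-element ones is a rotation of a
-- representative; 4-element subsets never occur as S(w) for w ∈ A_m
-- (the default value, the identity, is never used).
Λ₁ : Subset 5 → Fin 5 → Fin 5
Λ₁ S with findΛ reps S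
... | just f  = f
... | nothing = λ a → a

module _ {m : ℕ} .{{_ : NonZero m}} where

  Sw : V {m} → Subset 5
  Sw w = shiftDown (Z w)

  p : Subset 5 → Fin 5
  p Zs = Λ₁ (shiftDown Zs) (# 0)

  P : V {m} → V {m}
  P w = w +v q (p (Z w))

  layer : (V {m} → Fin 5) → V {m} → V {m}
  layer d w = w +v q (d w)

  dSch≥5 : Fin m → V {m} → Fin 5 → Fin 5
  dSch≥5 t w c with toℕ t
  ... | 0 = c
  ... | 1 = Λ₁ (Sw w) c
  ... | 2 = c ⊕ (# 3)
  ... | 3 = c ⊕ (# 4)
  ... | _ = c

  -- schedule (Sch_3): d_t(w,c)  (only t = 0,1,2 occur when m = 3)
  dSch3 : Fin m → V {m} → Fin 5 → Fin 5
  dSch3 t w c with toℕ t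
  ... | 0 = c ⊕ (# 4)
  ... | 1 = Λ₁ (Sw w) c
  ... | 2 = c ⊕ (# 3)
  ... | _ = c

{-# OPTIONS --safe #-}
module Submission where

-- A layer map w ↦ w + q (d w) is a bijection of A_m as soon as every v ∈ A_m admits exactly
-- one j with d (v − q_j) = j: the unique preimage of v is then v − q_j.  For the direction
-- d w = Λ₁ (S w) c, the zero set of v − q_j only depends on which coordinates of v are 0, 1
-- or something else (for the last coordinate: 0, −1 or something else), so there are 3^5
-- patterns to inspect.  Those on which the fixed point is not unique have at most one
-- coordinate of the third kind and so contradict Σ v = 0 already in ℤ_m for every m ≥ 2;
-- the others are checked by evaluation.  The layers with t ≠ 1 move in a constant direction.

open import Defs
open import Algebra.Bundles using (AbelianGroup)
open import Algebra.Structures using (IsAbelianGroup)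
import Algebra.Properties.AbelianGroup as AbelianGroupProperties
import Algebra.Properties.CommutativeSemigroup as CommutativeSemigroupProperties
open import Data.Bool using (Bool; true; false)
open import Data.Empty using (⊥-elim)
open import Data.Nat using (ℕ; zero; suc; NonZero; _+_; _∸_; _%_; _≤_; _<_; _≤?_; z≤n; s≤s; >-nonZero⁻¹)
import Data.Nat as ℕ
open import Data.Nat.DivMod using (%-distribˡ-+; m<n⇒m%n≡m; [m+n]%n≡m%n)
open import Data.Nat.Divisibility using (_∣_)
open import Data.Nat.Properties using (+-comm; +-assoc; m∸n+n≡m; <⇒≤; suc-injective; 1+n≢0)
open import Data.Fin using (Fin; toℕ; #_; _≟_)
open import Data.Fin.Patterns using (0F; 1F; 2F; 3F; 4F)
open import Data.Fin.Properties using (toℕ-fromℕ<; toℕ-injective; toℕ<n; any?; all?)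
open import Data.Fin.Subset using (Subset)
open import Data.Product using (Σ; ∃; ∃!; _×_; _,_)
open import Data.Vec using (Vec; []; _∷_; zipWith; foldr; map; _∷ʳ_; lookup; tabulate)
import Data.Vec as Vec
open import Data.Vec.Properties using (lookup-zipWith; tabulate-cong)
open import Data.Vec.Relation.Binary.Pointwise.Inductive using (Pointwise; []; _∷_; Pointwise-≡⇒≡)
open import Function.Base using (_∘_)
open import Function.Bundles using (_⇔_; mk⇔)
open import Relation.Binary.PropositionalEquality
open import Relation.Binary.PropositionalEquality.Algebra using (isMagma)
open import Relation.Nullary using (Dec; ¬_; ¬?; yes; no; does)
open import Relation.Nullary.Decidable using (map′; _×-dec_; _→-dec_; toWitness; dec-true; dec-false; does-⇔)
open import Relation.Unary using (Decidable)

UniqueFixedPoint : {A : Set} → (A → A) → Set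
UniqueFixedPoint f = ∃! _≡_ (λ x → f x ≡ x)

const-uniqueFixedPoint : {A : Set} (a : A) → UniqueFixedPoint (λ (_ : A) → a)
const-uniqueFixedPoint a = a , refl , λ a≡x → a≡x

uniqueFixedPoint-cong : {A : Set} {f g : A → A} → f ≗ g →
                        UniqueFixedPoint f → UniqueFixedPoint g
uniqueFixedPoint-cong f≗g (x , fx≡x , fixed⇒≡) =
  x , trans (sym (f≗g x)) fx≡x , λ gy≡y → fixed⇒≡ (trans (f≗g _) gy≡y)

unique? : ∀ {n p} {P : Fin n → Set p} → Decidable P → Dec (∃! _≡_ P)
unique? P? = map′ (λ (i , Pi , ∀j) → i , Pi , λ {j} → ∀j j)
                  (λ (i , Pi , ∀j) → i , Pi , λ j → ∀j {j})
                  (any? λ i → P? i ×-dec all? λ j → P? j →-dec i ≟ j)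

module _ {m : ℕ} .{{_ : NonZero m}} where

  toℕ-ι : ∀ n → toℕ (ι {m} n) ≡ n % m
  toℕ-ι n = toℕ-fromℕ< _

  ι-cong-% : ∀ {x y} → x % m ≡ y % m → ι {m} x ≡ ι y
  ι-cong-% {x} {y} eq = toℕ-injective (trans (toℕ-ι x) (trans eq (sym (toℕ-ι y))))

  ι-toℕ : (a : Fin m) → ι (toℕ a) ≡ a
  ι-toℕ a = toℕ-injective (trans (toℕ-ι (toℕ a)) (m<n⇒m%n≡m (toℕ<n a)))

  ι-+ : ∀ x y → ι {m} x ⊕ ι y ≡ ι (x + y)
  ι-+ x y = begin
    ι (toℕ (ι {m} x) + toℕ (ι {m} y)) ≡⟨ cong₂ (λ a b → ι (a + b)) (toℕ-ι x) (toℕ-ι y) ⟩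
    ι (x % m + y % m)                 ≡⟨ ι-cong-% (sym (%-distribˡ-+ x y m)) ⟩
    ι (x + y)                         ∎
    where open ≡-Reasoning

  1m≢0m : 1 < m → 1m {m} ≢ 0m
  1m≢0m 1<m 1≡0 = 1+n≢0 (begin
    1        ≡⟨ m<n⇒m%n≡m 1<m ⟨
    1 % m    ≡⟨ toℕ-ι 1 ⟨
    toℕ 1m   ≡⟨ cong toℕ 1≡0 ⟩
    toℕ 0m   ≡⟨ toℕ-ι 0 ⟩
    0 % m    ≡⟨ m<n⇒m%n≡m (>-nonZero⁻¹ m) ⟩
    0        ∎)
    where open ≡-Reasoning

  ⊕-comm : (a b : Fin m) → a ⊕ b ≡ b ⊕ a
  ⊕-comm a b = cong ι (+-comm (toℕ a) (toℕ b))

  ⊕-assoc : (a b c : Fin m) → (a ⊕ b) ⊕ c ≡ a ⊕ (b ⊕ c)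
  ⊕-assoc a b c = begin
    ι (toℕ a + toℕ b) ⊕ c               ≡⟨ cong (ι (toℕ a + toℕ b) ⊕_) (sym (ι-toℕ c)) ⟩
    ι (toℕ a + toℕ b) ⊕ ι (toℕ c)       ≡⟨ ι-+ (toℕ a + toℕ b) (toℕ c) ⟩
    ι (toℕ a + toℕ b + toℕ c)           ≡⟨ cong ι (+-assoc (toℕ a) (toℕ b) (toℕ c)) ⟩
    ι (toℕ a + (toℕ b + toℕ c))         ≡⟨ ι-+ (toℕ a) (toℕ b + toℕ c) ⟨
    ι (toℕ a) ⊕ ι (toℕ b + toℕ c)       ≡⟨ cong (_⊕ (b ⊕ c)) (ι-toℕ a) ⟩
    a ⊕ (b ⊕ c)                         ∎
    where open ≡-Reasoning

  ⊕-identityˡ : (a : Fin m) → 0m ⊕ a ≡ a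
  ⊕-identityˡ a = begin
    0m ⊕ a          ≡⟨ cong (0m ⊕_) (sym (ι-toℕ a)) ⟩
    0m ⊕ ι (toℕ a)  ≡⟨ ι-+ 0 (toℕ a) ⟩
    ι (toℕ a)       ≡⟨ ι-toℕ a ⟩
    a               ∎
    where open ≡-Reasoning

  ⊕-identityʳ : (a : Fin m) → a ⊕ 0m ≡ a
  ⊕-identityʳ a = trans (⊕-comm a 0m) (⊕-identityˡ a)

  ⊕-inverseˡ : (a : Fin m) → (⊖ a) ⊕ a ≡ 0m
  ⊕-inverseˡ a = begin
    ι (m ∸ toℕ a) ⊕ a          ≡⟨ cong (ι (m ∸ toℕ a) ⊕_) (sym (ι-toℕ a)) ⟩
    ι (m ∸ toℕ a) ⊕ ι (toℕ a)  ≡⟨ ι-+ (m ∸ toℕ a) (toℕ a) ⟩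
    ι (m ∸ toℕ a + toℕ a)      ≡⟨ cong ι (m∸n+n≡m (<⇒≤ (toℕ<n a))) ⟩
    ι m                        ≡⟨ ι-cong-% ([m+n]%n≡m%n 0 m) ⟩
    0m                         ∎
    where open ≡-Reasoning

  ⊕-⊖-isAbelianGroup : IsAbelianGroup _≡_ (_⊕_ {m}) 0m (λ a → ⊖ a)
  ⊕-⊖-isAbelianGroup = record
    { isGroup = record
      { isMonoid = record
        { isSemigroup = record { isMagma = isMagma _⊕_ ; assoc = ⊕-assoc }
        ; identity    = ⊕-identityˡ , ⊕-identityʳ
        }
      ; inverse = ⊕-inverseˡ , λ a → trans (⊕-comm a (⊖ a)) (⊕-inverseˡ a)
      ; ⁻¹-cong = cong (λ a → ⊖ a)
      }
    ; comm = ⊕-comm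
    }

  ⊕-⊖-abelianGroup : AbelianGroup _ _
  ⊕-⊖-abelianGroup = record { isAbelianGroup = ⊕-⊖-isAbelianGroup }

  open AbelianGroupProperties ⊕-⊖-abelianGroup public
  open CommutativeSemigroupProperties (AbelianGroup.commutativeSemigroup ⊕-⊖-abelianGroup) public
    using (interchange)

  sum : ∀ {n} → Vec (Fin m) n → Fin m
  sum = foldr _ _⊕_ 0m

  sum-zipWith-⊕ : ∀ {n} (xs ys : Vec (Fin m) n) → sum (zipWith _⊕_ xs ys) ≡ sum xs ⊕ sum ys
  sum-zipWith-⊕ [] [] = sym (⊕-identityˡ 0m)
  sum-zipWith-⊕ (x ∷ xs) (y ∷ ys) =
    trans (cong ((x ⊕ y) ⊕_) (sum-zipWith-⊕ xs ys)) (interchange x y (sum xs) (sum ys))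

  sum-∷ʳ : ∀ {n} (xs : Vec (Fin m) n) y → sum (xs ∷ʳ y) ≡ sum xs ⊕ y
  sum-∷ʳ [] y = trans (⊕-identityʳ y) (sym (⊕-identityˡ y))
  sum-∷ʳ (x ∷ xs) y = trans (cong (x ⊕_) (sum-∷ʳ xs y)) (sym (⊕-assoc x (sum xs) y))

  sum-map-ι : ∀ {n} (ns : Vec ℕ n) → sum (map ι ns) ≡ ι (Vec.sum ns)
  sum-map-ι [] = refl
  sum-map-ι (n ∷ ns) = trans (cong (ι n ⊕_) (sum-map-ι ns)) (ι-+ n (Vec.sum ns))

  w+u-u≡w : ∀ {n} (w u : Vec (Fin m) n) → zipWith _⊖_ (zipWith _⊕_ w u) u ≡ w
  w+u-u≡w [] [] = refl
  w+u-u≡w (a ∷ w) (b ∷ u) = cong₂ _∷_ (//-rightDividesʳ b a) (w+u-u≡w w u)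

  w-u+u≡w : ∀ {n} (w u : Vec (Fin m) n) → zipWith _⊕_ (zipWith _⊖_ w u) u ≡ w
  w-u+u≡w [] [] = refl
  w-u+u≡w (a ∷ w) (b ∷ u) = cong₂ _∷_ (//-rightDividesˡ b a) (w-u+u≡w w u)

  sum-zipWith-⊖ : ∀ {n} (xs ys : Vec (Fin m) n) → sum (zipWith _⊖_ xs ys) ≡ sum xs ⊖ sum ys
  sum-zipWith-⊖ xs ys = x≈z//y _ (sum ys) (sum xs) (begin
    sum (zipWith _⊖_ xs ys) ⊕ sum ys          ≡⟨ sum-zipWith-⊕ (zipWith _⊖_ xs ys) ys ⟨
    sum (zipWith _⊕_ (zipWith _⊖_ xs ys) ys)  ≡⟨ cong sum (w-u+u≡w xs ys) ⟩
    sum xs                                    ∎)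
    where open ≡-Reasoning

  sum-e : ∀ i → sumV (e {m} i) ≡ 1m
  sum-e 0F = sum-map-ι (1 ∷ 0 ∷ 0 ∷ 0 ∷ 0 ∷ [])
  sum-e 1F = sum-map-ι (0 ∷ 1 ∷ 0 ∷ 0 ∷ 0 ∷ [])
  sum-e 2F = sum-map-ι (0 ∷ 0 ∷ 1 ∷ 0 ∷ 0 ∷ [])
  sum-e 3F = sum-map-ι (0 ∷ 0 ∷ 0 ∷ 1 ∷ 0 ∷ [])
  sum-e 4F = sum-map-ι (0 ∷ 0 ∷ 0 ∷ 0 ∷ 1 ∷ [])

  sum[eᵢ-e₄]≡0 : ∀ i → sumV (e {m} i -v e 4F) ≡ 0m
  sum[eᵢ-e₄]≡0 i =
    trans (sum-zipWith-⊖ (e i) (e 4F)) (x≈y⇒x∙y⁻¹≈ε (trans (sum-e i) (sym (sum-e 4F))))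

  sum-q : ∀ j → sumV (q {m} j) ≡ 0m
  sum-q 0F = sum[eᵢ-e₄]≡0 0F
  sum-q 1F = sum[eᵢ-e₄]≡0 1F
  sum-q 2F = sum[eᵢ-e₄]≡0 2F
  sum-q 3F = sum[eᵢ-e₄]≡0 3F
  sum-q 4F = sum-map-ι (0 ∷ 0 ∷ 0 ∷ 0 ∷ 0 ∷ [])

  InA-+q : ∀ w j → InA {m} w → InA (w +v q j)
  InA-+q w j w∈A = begin
    sumV (w +v q j)      ≡⟨ sum-zipWith-⊕ w (q j) ⟩
    sumV w ⊕ sumV (q j)  ≡⟨ cong₂ _⊕_ w∈A (sum-q j) ⟩
    0m ⊕ 0m              ≡⟨ ⊕-identityˡ 0m ⟩
    0m                   ∎
    where open ≡-Reasoning

  InA-−q : ∀ v j → InA {m} v → InA (v -v q j)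
  InA-−q v j v∈A = begin
    sumV (v -v q j)      ≡⟨ sum-zipWith-⊖ v (q j) ⟩
    sumV v ⊖ sumV (q j)  ≡⟨ x≈y⇒x∙y⁻¹≈ε (trans v∈A (sym (sum-q j))) ⟩
    0m                   ∎
    where open ≡-Reasoning

  layer-bijective : (d : V {m} → Fin 5) →
                    (∀ v → InA v → UniqueFixedPoint (λ j → d (v -v q j))) →
                    BijOnA (layer d)
  layer-bijective d unique = (λ w → InA-+q w (d w)) , injective , onto
    where
    recovers-direction : ∀ w → d (layer d w -v q (d w)) ≡ d w
    recovers-direction w = cong d (w+u-u≡w w (q (d w)))

    injective : ∀ w w′ → InA w → InA w′ → layer d w ≡ layer d w′ → w ≡ w′
    injective w w′ w∈A _ eq = begin
      w                       ≡⟨ w+u-u≡w w (q (d w)) ⟨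
      layer d w -v q (d w)    ≡⟨ cong₂ (λ v j → v -v q j) eq same-direction ⟩
      layer d w′ -v q (d w′)  ≡⟨ w+u-u≡w w′ (q (d w′)) ⟩
      w′                      ∎
      where
      open ≡-Reasoning
      same-direction : d w ≡ d w′
      same-direction with unique (layer d w) (InA-+q w (d w) w∈A)
      ... | _ , _ , fixed⇒≡ =
        trans (sym (fixed⇒≡ (recovers-direction w)))
              (fixed⇒≡ (subst (λ v → d (v -v q (d w′)) ≡ d w′) (sym eq) (recovers-direction w′)))

    onto : ∀ v → InA v → Σ V λ w → InA w × layer d w ≡ v
    onto v v∈A with unique v v∈A
    ... | j , d≡j , _ =
      v -v q j , InA-−q v j v∈A , trans (cong (λ i → (v -v q j) +v q i) d≡j) (w-u+u≡w v (q j))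

data Class : Set where
  null unit other : Class

isNull isUnit : Class → Bool
isNull null = true
isNull _    = false
isUnit unit = true
isUnit _    = false

value freedom : Class → ℕ
value unit = 1
value _    = 0
freedom other = 1
freedom _     = 0

units frees : ∀ {n} → Vec Class n → ℕ
units τ = Vec.sum (map value τ)
frees τ = Vec.sum (map freedom τ)

-- Necessary conditions, from v₀ + v₁ + v₂ + v₃ = −v₄, on the classes τ of v₀ … v₃ and t
-- of −v₄ when at most one of these five values is of class other.
Consistent : ∀ {n} → Vec Class n → Class → Set
Consistent τ null  = (frees τ ≡ 0 → units τ ≢ 1) × (frees τ ≡ 1 → units τ ≢ 0)
Consistent τ unit  = (frees τ ≡ 0 → units τ ≢ 2) × (frees τ ≡ 1 → units τ ≢ 1)
Consistent τ other = frees τ ≡ 0 → 2 ≤ units τ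

consistent? : ∀ {n} (τ : Vec Class n) t → Dec (Consistent τ t)
consistent? τ null  = (frees τ ℕ.≟ 0 →-dec ¬? (units τ ℕ.≟ 1))
                 ×-dec (frees τ ℕ.≟ 1 →-dec ¬? (units τ ℕ.≟ 0))
consistent? τ unit  = (frees τ ℕ.≟ 0 →-dec ¬? (units τ ℕ.≟ 2))
                 ×-dec (frees τ ℕ.≟ 1 →-dec ¬? (units τ ℕ.≟ 1))
consistent? τ other = frees τ ℕ.≟ 0 →-dec 2 ≤? units τ

-- Z (v − q_j) in terms of the classes of v₀ … v₃ and of −v₄; the last coordinate is
-- negated because (q_j)₄ = −1 for j ≠ 4.
zeroPattern : Vec Class 4 → Class → Fin 5 → Subset 5
zeroPattern (t₀ ∷ t₁ ∷ t₂ ∷ t₃ ∷ []) t 0F = isUnit t₀ ∷ isNull t₁ ∷ isNull t₂ ∷ isNull t₃ ∷ isUnit t ∷ []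
zeroPattern (t₀ ∷ t₁ ∷ t₂ ∷ t₃ ∷ []) t 1F = isNull t₀ ∷ isUnit t₁ ∷ isNull t₂ ∷ isNull t₃ ∷ isUnit t ∷ []
zeroPattern (t₀ ∷ t₁ ∷ t₂ ∷ t₃ ∷ []) t 2F = isNull t₀ ∷ isNull t₁ ∷ isUnit t₂ ∷ isNull t₃ ∷ isUnit t ∷ []
zeroPattern (t₀ ∷ t₁ ∷ t₂ ∷ t₃ ∷ []) t 3F = isNull t₀ ∷ isNull t₁ ∷ isNull t₂ ∷ isUnit t₃ ∷ isUnit t ∷ []
zeroPattern (t₀ ∷ t₁ ∷ t₂ ∷ t₃ ∷ []) t 4F = isNull t₀ ∷ isNull t₁ ∷ isNull t₂ ∷ isNull t₃ ∷ isNull t ∷ []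

all-classes? : ∀ {p} {P : Class → Set p} → Decidable P → Dec (∀ t → P t)
all-classes? P? = map′ (λ (p₀ , p₁ , p₂) → λ { null → p₀ ; unit → p₁ ; other → p₂ })
                       (λ ∀P → ∀P null , ∀P unit , ∀P other)
                       (P? null ×-dec P? unit ×-dec P? other)

all-vectors? : ∀ {n p} {P : Vec Class n → Set p} → Decidable P → Dec (∀ τ → P τ)
all-vectors? {zero}  P? = map′ (λ p → λ { [] → p }) (λ ∀P → ∀P []) (P? [])
all-vectors? {suc n} P? = map′ (λ ∀P → λ { (t ∷ τ) → ∀P t τ }) (λ ∀P t τ → ∀P (t ∷ τ))
                               (all-classes? λ t → all-vectors? λ τ → P? (t ∷ τ))

Λ₁-unique-on-consistent-patterns : ∀ τ t → Consistent τ t → ∀ c →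
                                   UniqueFixedPoint (λ j → Λ₁ (shiftDown (zeroPattern τ t j)) c)
Λ₁-unique-on-consistent-patterns = toWitness {a? = decision} _
  where
  decision : Dec (∀ τ t → Consistent τ t → ∀ c →
                  UniqueFixedPoint (λ j → Λ₁ (shiftDown (zeroPattern τ t j)) c))
  decision = all-vectors? λ τ → all-classes? λ t → consistent? τ t →-dec
             all? λ c → unique? λ j → Λ₁ (shiftDown (zeroPattern τ t j)) c ≟ j

module _ {m : ℕ} .{{_ : NonZero m}} where

  data ClassOf (a : Fin m) : Class → Set where
    null  : a ≡ 0m → ClassOf a null
    unit  : a ≡ 1m → ClassOf a unit
    other : a ≢ 0m → a ≢ 1m → ClassOf a other

  classify : (a : Fin m) → ∃ (ClassOf a)
  classify a with a ≟ 0m | a ≟ 1m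
  ... | yes a≡0 | _       = null , null a≡0
  ... | no _    | yes a≡1 = unit , unit a≡1
  ... | no a≢0  | no a≢1  = other , other a≢0 a≢1

  classifyAll : ∀ {n} (xs : Vec (Fin m) n) → ∃ λ (τ : Vec Class n) → Pointwise ClassOf xs τ
  classifyAll []       = [] , []
  classifyAll (x ∷ xs) with classify x | classifyAll xs
  ... | t , x∶t | τ , xs∶τ = t ∷ τ , x∶t ∷ xs∶τ

  freePart : Class → Fin m → Fin m
  freePart other a = a
  freePart _     _ = 0m

  freeSum : ∀ {n} → Vec Class n → Vec (Fin m) n → Fin m
  freeSum τ xs = sum (zipWith freePart τ xs)

  ClassOf⇒≡ : ∀ {a t} → ClassOf a t → a ≡ ι (value t) ⊕ freePart t a
  ClassOf⇒≡ (null a≡0)  = trans a≡0 (sym (⊕-identityˡ 0m))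
  ClassOf⇒≡ (unit a≡1)  = trans a≡1 (sym (⊕-identityʳ 1m))
  ClassOf⇒≡ (other _ _) = sym (⊕-identityˡ _)

  sum-classified : ∀ {n} {xs : Vec (Fin m) n} {τ} → Pointwise ClassOf xs τ →
                   sum xs ≡ ι (units τ) ⊕ freeSum τ xs
  sum-classified [] = sym (⊕-identityˡ 0m)
  sum-classified {xs = x ∷ xs} {t ∷ τ} (x∶t ∷ xs∶τ) = begin
    x ⊕ sum xs
      ≡⟨ cong₂ _⊕_ (ClassOf⇒≡ x∶t) (sum-classified xs∶τ) ⟩
    (ι (value t) ⊕ freePart t x) ⊕ (ι (units τ) ⊕ freeSum τ xs)
      ≡⟨ interchange (ι (value t)) (freePart t x) (ι (units τ)) (freeSum τ xs) ⟩
    (ι (value t) ⊕ ι (units τ)) ⊕ (freePart t x ⊕ freeSum τ xs)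
      ≡⟨ cong (_⊕ (freePart t x ⊕ freeSum τ xs)) (ι-+ (value t) (units τ)) ⟩
    ι (value t + units τ) ⊕ freeSum (t ∷ τ) (x ∷ xs)
      ∎
    where open ≡-Reasoning

  no-frees⇒freeSum≡0 : ∀ {n} {xs : Vec (Fin m) n} {τ} → Pointwise ClassOf xs τ →
                       frees τ ≡ 0 → freeSum τ xs ≡ 0m
  no-frees⇒freeSum≡0 []                 _  = refl
  no-frees⇒freeSum≡0 (null _ ∷ xs∶τ)    τ₀ = trans (⊕-identityˡ _) (no-frees⇒freeSum≡0 xs∶τ τ₀)
  no-frees⇒freeSum≡0 (unit _ ∷ xs∶τ)    τ₀ = trans (⊕-identityˡ _) (no-frees⇒freeSum≡0 xs∶τ τ₀)
  no-frees⇒freeSum≡0 (other _ _ ∷ _)    ()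

  one-free⇒freeSum≢0 : ∀ {n} {xs : Vec (Fin m) n} {τ} → Pointwise ClassOf xs τ →
                       frees τ ≡ 1 → freeSum τ xs ≢ 0m
  one-free⇒freeSum≢0 (null _ ∷ xs∶τ) τ₁ = one-free⇒freeSum≢0 xs∶τ τ₁ ∘ trans (sym (⊕-identityˡ _))
  one-free⇒freeSum≢0 (unit _ ∷ xs∶τ) τ₁ = one-free⇒freeSum≢0 xs∶τ τ₁ ∘ trans (sym (⊕-identityˡ _))
  one-free⇒freeSum≢0 {xs = x ∷ xs} {_ ∷ τ} (other x≢0 _ ∷ xs∶τ) τ₁ x+F≡0 = x≢0 (begin
    x                   ≡⟨ ⊕-identityʳ x ⟨
    x ⊕ 0m              ≡⟨ cong (x ⊕_) (no-frees⇒freeSum≡0 xs∶τ (suc-injective τ₁)) ⟨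
    x ⊕ freeSum τ xs    ≡⟨ x+F≡0 ⟩
    0m                  ∎)
    where open ≡-Reasoning

  ι≢0,1⇒2≤ : ∀ n → ι {m} n ≢ 0m → ι n ≢ 1m → 2 ≤ n
  ι≢0,1⇒2≤ 0             ι≢0 _   = ⊥-elim (ι≢0 refl)
  ι≢0,1⇒2≤ 1             _   ι≢1 = ⊥-elim (ι≢1 refl)
  ι≢0,1⇒2≤ (suc (suc _)) _   _   = s≤s (s≤s z≤n)

  does-≟-⊖ : (a b : Fin m) → does (a ≟ b) ≡ does (⊖ a ≟ ⊖ b)
  does-≟-⊖ a b = does-⇔ (mk⇔ (cong (λ x → ⊖ x)) ⁻¹-injective) (a ≟ b) (⊖ a ≟ ⊖ b)

  Z-−v : (v w : V {m}) → Z (v -v w) ≡ tabulate (λ i → does (lookup v i ≟ lookup w i))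
  Z-−v v w = tabulate-cong λ i → begin
    does (lookup (v -v w) i ≟ 0m)        ≡⟨ cong (λ a → does (a ≟ 0m)) (lookup-zipWith _⊖_ i v w) ⟩
    does (lookup v i ⊖ lookup w i ≟ 0m)  ≡⟨ does-⇔ (difference≡0⇔≡ (lookup v i) (lookup w i))
                                                    (lookup v i ⊖ lookup w i ≟ 0m) (lookup v i ≟ lookup w i) ⟩
    does (lookup v i ≟ lookup w i)       ∎
    where
    open ≡-Reasoning
    difference≡0⇔≡ : ∀ a b → (a ⊖ b ≡ 0m) ⇔ (a ≡ b)
    difference≡0⇔≡ a b = mk⇔ (x∙y⁻¹≈ε⇒x≈y a b) x≈y⇒x∙y⁻¹≈ε

  module _ (1≢0 : 1m {m} ≢ 0m) where

    known-last-consistent : ∀ {n} {xs : Vec (Fin m) n} {τ} k →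
                            Pointwise ClassOf xs τ → sum xs ≡ ι k →
                            (frees τ ≡ 0 → units τ ≢ suc k) × (frees τ ≡ 1 → units τ ≢ k)
    known-last-consistent {xs = xs} {τ} k xs∶τ Σ≡k = no-free , one-free
      where
      open ≡-Reasoning
      decomposed : ι (units τ) ⊕ freeSum τ xs ≡ ι k
      decomposed = trans (sym (sum-classified xs∶τ)) Σ≡k

      no-free : frees τ ≡ 0 → units τ ≢ suc k
      no-free τ₀ u≡1+k = 1≢0 (∙-cancelʳ (ι k) 1m 0m (begin
        1m ⊕ ι k                     ≡⟨ ι-+ 1 k ⟩
        ι (suc k)                    ≡⟨ cong ι u≡1+k ⟨
        ι (units τ)                  ≡⟨ ⊕-identityʳ _ ⟨
        ι (units τ) ⊕ 0m             ≡⟨ cong (ι (units τ) ⊕_) (no-frees⇒freeSum≡0 xs∶τ τ₀) ⟨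
        ι (units τ) ⊕ freeSum τ xs   ≡⟨ decomposed ⟩
        ι k                          ≡⟨ ⊕-identityˡ (ι k) ⟨
        0m ⊕ ι k                     ∎))

      one-free : frees τ ≡ 1 → units τ ≢ k
      one-free τ₁ u≡k = one-free⇒freeSum≢0 xs∶τ τ₁ (∙-cancelˡ (ι k) _ _ (begin
        ι k ⊕ freeSum τ xs           ≡⟨ cong (λ n → ι n ⊕ freeSum τ xs) u≡k ⟨
        ι (units τ) ⊕ freeSum τ xs   ≡⟨ decomposed ⟩
        ι k                          ≡⟨ ⊕-identityʳ (ι k) ⟨
        ι k ⊕ 0m                     ∎))

    consistent : ∀ {n} {xs : Vec (Fin m) n} {τ b t} → Pointwise ClassOf xs τ → ClassOf b t →
                 sum xs ≡ b → Consistent τ t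
    consistent xs∶τ (null b≡0) Σ≡b = known-last-consistent 0 xs∶τ (trans Σ≡b b≡0)
    consistent xs∶τ (unit b≡1) Σ≡b = known-last-consistent 1 xs∶τ (trans Σ≡b b≡1)
    consistent {xs = xs} {τ} {b} xs∶τ (other b≢0 b≢1) Σ≡b τ₀ =
      ι≢0,1⇒2≤ (units τ) (b≢0 ∘ trans b≡ι) (b≢1 ∘ trans b≡ι)
      where
      open ≡-Reasoning
      b≡ι : b ≡ ι (units τ)
      b≡ι = begin
        b                            ≡⟨ Σ≡b ⟨
        sum xs                       ≡⟨ sum-classified xs∶τ ⟩
        ι (units τ) ⊕ freeSum τ xs   ≡⟨ cong (ι (units τ) ⊕_) (no-frees⇒freeSum≡0 xs∶τ τ₀) ⟩
        ι (units τ) ⊕ 0m             ≡⟨ ⊕-identityʳ _ ⟩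
        ι (units τ)                  ∎

    null-test : ∀ {a b t} → ClassOf a t → b ≡ 0m → does (a ≟ b) ≡ isNull t
    null-test {a} {b} (null a≡0)    b≡0 = dec-true (a ≟ b) (trans a≡0 (sym b≡0))
    null-test {a} {b} (unit a≡1)    b≡0 =
      dec-false (a ≟ b) λ a≡b → 1≢0 (trans (sym a≡1) (trans a≡b b≡0))
    null-test {a} {b} (other a≢0 _) b≡0 = dec-false (a ≟ b) λ a≡b → a≢0 (trans a≡b b≡0)

    unit-test : ∀ {a b t} → ClassOf a t → b ≡ 1m → does (a ≟ b) ≡ isUnit t
    unit-test {a} {b} (null a≡0)    b≡1 =
      dec-false (a ≟ b) λ a≡b → 1≢0 (trans (sym b≡1) (trans (sym a≡b) a≡0))
    unit-test {a} {b} (unit a≡1)    b≡1 = dec-true (a ≟ b) (trans a≡1 (sym b≡1))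
    unit-test {a} {b} (other _ a≢1) b≡1 = dec-false (a ≟ b) λ a≡b → a≢1 (trans a≡b b≡1)

    Z-after-step : ∀ {τ t} a₀ a₁ a₂ a₃ a₄ →
                   Pointwise ClassOf (a₀ ∷ a₁ ∷ a₂ ∷ a₃ ∷ []) τ → ClassOf (⊖ a₄) t →
                   ∀ j → Z ((a₀ ∷ a₁ ∷ a₂ ∷ a₃ ∷ a₄ ∷ []) -v q j) ≡ zeroPattern τ t j
    Z-after-step {t = t} a₀ a₁ a₂ a₃ a₄ (c₀ ∷ c₁ ∷ c₂ ∷ c₃ ∷ []) c j =
      trans (Z-−v v (q j)) (Pointwise-≡⇒≡ (entries j))
      where
      v : V
      v = a₀ ∷ a₁ ∷ a₂ ∷ a₃ ∷ a₄ ∷ []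

      0-0≡0 : 0m ⊖ 0m ≡ 0m {m}
      0-0≡0 = x≈y⇒x∙y⁻¹≈ε refl

      1-0≡1 : 1m ⊖ 0m ≡ 1m {m}
      1-0≡1 = trans (cong (1m ⊕_) ε⁻¹≈ε) (⊕-identityʳ 1m)

      last-unit : does (a₄ ≟ 0m ⊖ 1m) ≡ isUnit t
      last-unit = trans (does-≟-⊖ a₄ (0m ⊖ 1m)) (unit-test c (trans (⁻¹-anti-homo‿- 0m 1m) 1-0≡1))

      entries : ∀ j → Pointwise _≡_ (tabulate λ i → does (lookup v i ≟ lookup (q j) i))
                                    (zeroPattern (_ ∷ _ ∷ _ ∷ _ ∷ []) _ j)
      entries 0F = unit-test c₀ 1-0≡1 ∷ null-test c₁ 0-0≡0 ∷ null-test c₂ 0-0≡0 ∷ null-test c₃ 0-0≡0 ∷ last-unit ∷ []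
      entries 1F = null-test c₀ 0-0≡0 ∷ unit-test c₁ 1-0≡1 ∷ null-test c₂ 0-0≡0 ∷ null-test c₃ 0-0≡0 ∷ last-unit ∷ []
      entries 2F = null-test c₀ 0-0≡0 ∷ null-test c₁ 0-0≡0 ∷ unit-test c₂ 1-0≡1 ∷ null-test c₃ 0-0≡0 ∷ last-unit ∷ []
      entries 3F = null-test c₀ 0-0≡0 ∷ null-test c₁ 0-0≡0 ∷ null-test c₂ 0-0≡0 ∷ unit-test c₃ 1-0≡1 ∷ last-unit ∷ []
      entries 4F = null-test c₀ refl ∷ null-test c₁ refl ∷ null-test c₂ refl ∷ null-test c₃ refl
                 ∷ trans (does-≟-⊖ a₄ 0m) (null-test c ε⁻¹≈ε) ∷ []

    Λ₁-step-unique : ∀ c v → InA v → UniqueFixedPoint (λ j → Λ₁ (Sw {m} (v -v q j)) c)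
    Λ₁-step-unique c v@(a₀ ∷ a₁ ∷ a₂ ∷ a₃ ∷ a₄ ∷ []) v∈A
      with classifyAll (a₀ ∷ a₁ ∷ a₂ ∷ a₃ ∷ []) | classify (⊖ a₄)
    ... | τ , xs∶τ | t , c₄ =
      uniqueFixedPoint-cong same-zeros
        (Λ₁-unique-on-consistent-patterns τ t (consistent xs∶τ c₄ balanced) c)
      where
      balanced : sum (a₀ ∷ a₁ ∷ a₂ ∷ a₃ ∷ []) ≡ ⊖ a₄
      balanced = inverseˡ-unique _ a₄ (trans (sym (sum-∷ʳ (a₀ ∷ a₁ ∷ a₂ ∷ a₃ ∷ []) a₄)) v∈A)

      same-zeros : (λ j → Λ₁ (shiftDown (zeroPattern τ t j)) c) ≗ (λ j → Λ₁ (Sw (v -v q j)) c)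
      same-zeros j = cong (λ S → Λ₁ (shiftDown S) c) (sym (Z-after-step a₀ a₁ a₂ a₃ a₄ xs∶τ c₄ j))

    schedule≥5-unique : ∀ t c v → InA v → UniqueFixedPoint (λ j → dSch≥5 t (v -v q j) c)
    schedule≥5-unique t c v v∈A with toℕ t
    ... | 0                       = const-uniqueFixedPoint c
    ... | 1                       = Λ₁-step-unique c v v∈A
    ... | 2                       = const-uniqueFixedPoint (c ⊕ # 3)
    ... | 3                       = const-uniqueFixedPoint (c ⊕ # 4)
    ... | suc (suc (suc (suc _))) = const-uniqueFixedPoint c

    schedule₃-unique : ∀ t c v → InA v → UniqueFixedPoint (λ j → dSch3 t (v -v q j) c)
    schedule₃-unique t c v v∈A with toℕ t
    ... | 0                 = const-uniqueFixedPoint (c ⊕ # 4)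
    ... | 1                 = Λ₁-step-unique c v v∈A
    ... | 2                 = const-uniqueFixedPoint (c ⊕ # 3)
    ... | suc (suc (suc _)) = const-uniqueFixedPoint c

-- Only 1 ≠ 0 in ℤ_m, i.e. m ≥ 2, is used.
mainTheorem4 : (m : ℕ) .{{_ : NonZero m}} → 3 ≤ m → ¬ (2 ∣ m) →
    BijOnA {m} P
    × (5 ≤ m → (t : Fin m) (c : Fin 5) → BijOnA {m} (layer (λ w → dSch≥5 t w c)))
    × (m ≡ 3 → (t : Fin m) (c : Fin 5) → BijOnA {m} (layer (λ w → dSch3 t w c)))
mainTheorem4 m 3≤m _ =
    layer-bijective (λ w → Λ₁ (Sw w) (# 0)) (Λ₁-step-unique 1≢0 (# 0))
  , (λ _ t c → layer-bijective (λ w → dSch≥5 t w c) (schedule≥5-unique 1≢0 t c))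
  , (λ _ t c → layer-bijective (λ w → dSch3 t w c) (schedule₃-unique 1≢0 t c))
  where
  1≢0 : 1m {m} ≢ 0m
  1≢0 = 1m≢0m (<⇒≤ 3≤m)
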